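{- Let $p$ be an odd prime, $s\ge1$ and $k\ge1$ integers, and $0<\lambda<p^s$ an integer. Write $\lambda=p^r\lambda'$ with $0\le r<s$ and $p\nmid\lambda'$. Then $$\rho_{k,\lambda}(p^s)=\sum_{i=0}^{\lfloor r/2\rfloor}p^{ki+(s-2i-1)(k-1)}\cdot\rho^{(1)}_{k,\lambda/p^{2i}}(p).$$
   Context: For positive integers $k,n$ and an integer $\mu$, $\rho_{k,\mu}(n)$ is the number of $(x_1,\dots,x_k)\in(\mathbb{Z}/n\mathbb{Z})^k$ with $x_1^2+\cdots+x_k^2\equiv\mu\pmod n$. For a prime $p$, integers $t\ge1$ and $\mu$, $\rho^{(1)}_{k,\mu}(p^t)$ is the number of such solutions modulo $p^t$ (i.e. $(x_1,\dots,x_k)\in(\mathbb{Z}/p^t\mathbb{Z})^k$ with $x_1^2+\cdots+x_k^2\equiv\mu\pmod{p^t}$) for which $p\nmid x_i$ for at least one $i$. -}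

module Defs where

open import Data.Nat as ℕ using (ℕ; zero; suc; _+_)
open import Data.Nat.Divisibility using (_∣_; _∣?_)
open import Data.Fin using (Fin; toℕ)
open import Data.Vec using (Vec; []; _∷_)
open import Data.List using (List; [_]; concatMap; map; filter; length; allFin)
open import Data.Integer as ℤ using (ℤ; +_; _-_; ∣_∣)
open import Data.Product using (_×_)
open import Data.Vec.Relation.Unary.Any using (Any; any?)
open import Relation.Nullary using (¬_; Dec)
open import Relation.Nullary.Decidable using (_×-dec_; ¬?)

allTuples : (k n : ℕ) → List (Vec (Fin n) k)
allTuples zero    n = [ [] ]
allTuples (suc k) n = concatMap (λ x → map (x ∷_) (allTuples k n)) (allFin n)

sumSq : ∀ {n k} → Vec (Fin n) k → ℤ
sumSq []       = + 0
sumSq (x ∷ xs) = (+ toℕ x) ℤ.* (+ toℕ x) ℤ.+ sumSq xs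

_≡_[mod_] : ℤ → ℤ → ℕ → Set
a ≡ b [mod n ] = n ∣ ∣ a - b ∣

_≡?_[mod_] : ∀ a b n → Dec (a ≡ b [mod n ])
a ≡? b [mod n ] = n ∣? ∣ a - b ∣

ρ : (k : ℕ) (μ : ℤ) (n : ℕ) → ℕ
ρ k μ n = length (filter (λ v → sumSq v ≡? μ [mod n ]) (allTuples k n))

ρ⁽¹⁾ : (k : ℕ) (μ : ℤ) (p t : ℕ) → ℕ
ρ⁽¹⁾ k μ p t = length (filter
  (λ v → (sumSq v ≡? μ [mod p ℕ.^ t ]) ×-dec any? (λ x → ¬? (p ∣? toℕ x)) v)
  (allTuples k (p ℕ.^ t)))

sumUpTo : ℕ → (ℕ → ℕ) → ℕ
sumUpTo zero    f = f 0
sumUpTo (suc n) f = sumUpTo n f + f (suc n)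

{-# OPTIONS --safe #-}
module Submission where

-- Split the solutions modulo pˢ into primitive ones (some xᵢ prime to p) and imprimitive ones.
-- Writing a residue modulo p q (p ∣ q) as a + q b with a < q and b < p, the congruence
-- |a + q b|² ≡ λ (mod p q) holds iff |a|² = λ + q c for some c and 2a·b ≡ -c (mod p).  For
-- primitive a and odd p this linear congruence has p^(k-1) solutions b, so the primitive solutions
-- modulo pˢ number p^((s-1)(k-1)) ρ⁽¹⁾(p).  An imprimitive solution is p y, which forces p² ∣ λ and
-- then gives p^k ρ_{k,λ/p²}(p^(s-2)) of them; unfolding this recursion ⌊r/2⌋ times yields the formula.

open import Defs
open import Data.Nat using (ℕ; _+_; _*_; _∸_; _^_; _<_; _≤_; _/_)
open import Data.Nat.Divisibility using (_∣_)
open import Data.Nat.Properties using (m^n≢0)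
open import Data.Nat.Primality using (Prime; prime⇒nonZero)
open import Data.Integer using (+_)
open import Relation.Binary.PropositionalEquality using (_≡_; _≢_)
open import Relation.Nullary using (¬_)

open import Data.Nat as ℕ using (zero; suc; z≤n; s≤s; z<s; >-nonZero⁻¹)
open import Data.Nat.Properties
  using ( +-assoc; +-comm; +-identityʳ; *-identityˡ; *-identityʳ; *-zeroʳ; *-assoc; *-comm; *-suc
        ; *-distribˡ-+; suc-injective; ⊔-lub; ≤-<-trans; m*n≢0; ^-distribˡ-+-* )
open import Data.Nat.Tactic.RingSolver using (solve-∀)
open import Data.Nat.Divisibility as ℕ∣ using (_∣?_; >⇒∤)
open import Data.Nat.DivMod using (n/1≡n; /-congʳ; m*n/m*o≡n/o; m/n≡1+[m∸n]/n)
open import Data.Nat.Coprimality using (Coprime; coprime-Bézout)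
open import Data.Nat.GCD using (module Bézout)
open import Data.Nat.Primality using (euclidsLemma; prime⇒irreducible; prime[2]; ¬prime[1])
open import Data.Nat.ListAction using (sum)
open import Data.Nat.ListAction.Properties using (sum-++)
open import Data.Integer as ℤ using (ℤ; 1ℤ)
open import Data.Integer.Properties as ℤ using (∣m⊝n∣≤m⊔n; [+m]-[+n]≡m⊖n; ∣i∣≡0⇒i≡0; i-j≡0⇒i≡j)
open import Data.Integer.Divisibility.Signed as Signed using (divides)
open import Data.Integer.DivMod using (_%ℕ_; _/ℕ_; n%ℕd<d; a≡a%ℕn+[a/ℕn]*n)
import Data.Integer.Tactic.RingSolver as ℤ-Solver
open import Data.Fin using (Fin; toℕ)
open import Data.List as List using (List; filter; length; concatMap; allFin; tabulate)
open import Data.List.Properties using (map-++; map-∘; map-tabulate)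
open import Data.Vec as Vec using (Vec; []; _∷_; zipWith)
open import Data.Vec.Relation.Unary.Any as Any using (Any; any?; here; there)
import Data.Vec.Relation.Unary.Any.Properties as Anyₚ
open import Data.Product using (Σ; _×_; _,_)
open import Data.Sum using (inj₁; inj₂; fromInj₂)
open import Data.Empty using (⊥-elim)
open import Function using (_∘_; _⇔_; mk⇔; Equivalence)
open import Function.Properties.Equivalence using () renaming (trans to ⇔-trans)
open import Relation.Nullary using (Dec; yes; no; contradiction)
open import Relation.Nullary.Decidable using (_×-dec_; ¬?; decidable-stable)
open import Relation.Binary.PropositionalEquality
  using (refl; sym; trans; cong; cong₂; subst; module ≡-Reasoning)

sumBelow : ℕ → (ℕ → ℕ) → ℕ
sumBelow zero    f = 0
sumBelow (suc n) f = f 0 + sumBelow n (f ∘ suc)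

sumBelow-cong< : ∀ n {f g : ℕ → ℕ} → (∀ i → i < n → f i ≡ g i) → sumBelow n f ≡ sumBelow n g
sumBelow-cong< zero    f≗g = refl
sumBelow-cong< (suc n) f≗g =
  cong₂ _+_ (f≗g 0 z<s) (sumBelow-cong< n (λ i i<n → f≗g (suc i) (s≤s i<n)))

sumBelow-cong : ∀ n {f g : ℕ → ℕ} → (∀ i → f i ≡ g i) → sumBelow n f ≡ sumBelow n g
sumBelow-cong n f≗g = sumBelow-cong< n (λ i _ → f≗g i)

sumBelow-distrib : ∀ n (f g : ℕ → ℕ) → sumBelow n (λ i → f i + g i) ≡ sumBelow n f + sumBelow n g
sumBelow-distrib zero    f g = refl
sumBelow-distrib (suc n) f g rewrite sumBelow-distrib n (f ∘ suc) (g ∘ suc) =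
  interchange (f 0) (g 0) _ _
  where
  interchange : ∀ a b c d → a + b + (c + d) ≡ a + c + (b + d)
  interchange = solve-∀

sumBelow-*ˡ : ∀ n c (f : ℕ → ℕ) → sumBelow n (λ i → c * f i) ≡ c * sumBelow n f
sumBelow-*ˡ zero    c f = sym (*-zeroʳ c)
sumBelow-*ˡ (suc n) c f =
  trans (cong (_+_ (c * f 0)) (sumBelow-*ˡ n c (f ∘ suc))) (sym (*-distribˡ-+ c (f 0) _))

sumBelow-const : ∀ n c → sumBelow n (λ _ → c) ≡ n * c
sumBelow-const zero    c = refl
sumBelow-const (suc n) c = cong (_+_ c) (sumBelow-const n c)

sumBelow-comm : ∀ n m (f : ℕ → ℕ → ℕ) →
  sumBelow n (λ i → sumBelow m (f i)) ≡ sumBelow m (λ j → sumBelow n (λ i → f i j))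
sumBelow-comm zero    m f = sym (trans (sumBelow-const m 0) (*-zeroʳ m))
sumBelow-comm (suc n) m f = trans (cong (_+_ (sumBelow m (f 0))) (sumBelow-comm n m (f ∘ suc)))
  (sym (sumBelow-distrib m (f 0) _))

sumBelow-+ : ∀ m n (f : ℕ → ℕ) → sumBelow (m + n) f ≡ sumBelow m f + sumBelow n (λ i → f (m + i))
sumBelow-+ zero    n f = refl
sumBelow-+ (suc m) n f rewrite sumBelow-+ m n (f ∘ suc) = sym (+-assoc (f 0) _ _)

sumBelow-digits : ∀ n m (f : ℕ → ℕ) →
  sumBelow (n * m) f ≡ sumBelow n (λ b → sumBelow m (λ a → f (a + b * m)))
sumBelow-digits zero    m f = refl
sumBelow-digits (suc n) m f = trans (sumBelow-+ m (n * m) f) (cong₂ _+_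
  (sumBelow-cong m (λ a → cong f (sym (+-identityʳ a))))
  (trans (sumBelow-digits n m (λ i → f (m + i)))
         (sumBelow-cong n (λ b → sumBelow-cong m (λ a → cong f (shift m a b))))))
  where
  shift : ∀ m a b → m + (a + b * m) ≡ a + suc b * m
  shift = solve-∀

sumBelow-single : ∀ n u (f : ℕ → ℕ) → u < n → (∀ i → i < n → i ≢ u → f i ≡ 0) →
  sumBelow n f ≡ f u
sumBelow-single (suc n) zero f u<n others = trans
  (cong (_+_ (f 0)) (trans (sumBelow-cong< n (λ i i<n → others (suc i) (s≤s i<n) λ ()))
                           (trans (sumBelow-const n 0) (*-zeroʳ n))))
  (+-identityʳ (f 0))
sumBelow-single (suc n) (suc u) f (s≤s u<n) others = trans
  (cong (_+ sumBelow n (f ∘ suc)) (others 0 z<s λ ()))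
  (sumBelow-single n u (f ∘ suc) u<n (λ i i<n i≢u → others (suc i) (s≤s i<n) (i≢u ∘ suc-injective)))

sumTuples : (k n : ℕ) → (Vec ℕ k → ℕ) → ℕ
sumTuples zero    n h = h []
sumTuples (suc k) n h = sumBelow n (λ x → sumTuples k n (h ∘ (x ∷_)))

sumTuples-cong : ∀ k n {g h : Vec ℕ k → ℕ} → (∀ xs → g xs ≡ h xs) → sumTuples k n g ≡ sumTuples k n h
sumTuples-cong zero    n g≗h = g≗h []
sumTuples-cong (suc k) n g≗h = sumBelow-cong n (λ x → sumTuples-cong k n (g≗h ∘ (x ∷_)))

sumTuples-distrib : ∀ k n (g h : Vec ℕ k → ℕ) →
  sumTuples k n (λ xs → g xs + h xs) ≡ sumTuples k n g + sumTuples k n h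
sumTuples-distrib zero    n g h = refl
sumTuples-distrib (suc k) n g h = trans
  (sumBelow-cong n (λ x → sumTuples-distrib k n (g ∘ (x ∷_)) (h ∘ (x ∷_)))) (sumBelow-distrib n _ _)

sumTuples-*ˡ : ∀ k n c (h : Vec ℕ k → ℕ) → sumTuples k n (λ xs → c * h xs) ≡ c * sumTuples k n h
sumTuples-*ˡ zero    n c h = refl
sumTuples-*ˡ (suc k) n c h =
  trans (sumBelow-cong n (λ x → sumTuples-*ˡ k n c (h ∘ (x ∷_)))) (sumBelow-*ˡ n c _)

sumTuples-const : ∀ k n c → sumTuples k n (λ _ → c) ≡ n ^ k * c
sumTuples-const zero    n c = sym (+-identityʳ c)
sumTuples-const (suc k) n c = trans (sumBelow-cong n (λ _ → sumTuples-const k n c))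
  (trans (sumBelow-const n _) (sym (*-assoc n (n ^ k) c)))

sumTuples-zero : ∀ k n (h : Vec ℕ k → ℕ) → (∀ xs → h xs ≡ 0) → sumTuples k n h ≡ 0
sumTuples-zero k n h h≗0 =
  trans (sumTuples-cong k n h≗0) (trans (sumTuples-const k n 0) (*-zeroʳ (n ^ k)))

sumTuples-sumBelow : ∀ k n m (h : Vec ℕ k → ℕ → ℕ) →
  sumTuples k n (λ xs → sumBelow m (h xs)) ≡ sumBelow m (λ j → sumTuples k n (λ xs → h xs j))
sumTuples-sumBelow zero    n m h = refl
sumTuples-sumBelow (suc k) n m h =
  trans (sumBelow-cong n (λ x → sumTuples-sumBelow k n m (h ∘ (x ∷_)))) (sumBelow-comm n m _)

liftBy : ∀ {k} → ℕ → Vec ℕ k → Vec ℕ k → Vec ℕ k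
liftBy m = zipWith (λ a b → a + b * m)

sumTuples-digits : ∀ k n m (h : Vec ℕ k → ℕ) →
  sumTuples k (n * m) h ≡ sumTuples k m (λ as → sumTuples k n (λ bs → h (liftBy m as bs)))
sumTuples-digits zero    n m h = refl
sumTuples-digits (suc k) n m h = begin
  sumBelow (n * m) (λ x → sumTuples k (n * m) (h ∘ (x ∷_)))
    ≡⟨ sumBelow-digits n m _ ⟩
  sumBelow n (λ b → sumBelow m (λ a → sumTuples k (n * m) (h ∘ (a + b * m ∷_))))
    ≡⟨ sumBelow-cong n (λ b → sumBelow-cong m (λ a → sumTuples-digits k n m _)) ⟩
  sumBelow n (λ b → sumBelow m (λ a → sumTuples k m (λ as → sumTuples k n (λ bs → h′ a b as bs))))
    ≡⟨ sumBelow-comm n m _ ⟩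
  sumBelow m (λ a → sumBelow n (λ b → sumTuples k m (λ as → sumTuples k n (λ bs → h′ a b as bs))))
    ≡⟨ sumBelow-cong m (λ a → sym (sumTuples-sumBelow k m n _)) ⟩
  sumBelow m (λ a → sumTuples k m (λ as → sumBelow n (λ b → sumTuples k n (λ bs → h′ a b as bs)))) ∎
  where
  open ≡-Reasoning
  h′ : ℕ → ℕ → Vec ℕ k → Vec ℕ k → ℕ
  h′ a b as bs = h (a + b * m ∷ liftBy m as bs)

sumUpTo-cong : ∀ n {f g : ℕ → ℕ} → (∀ i → f i ≡ g i) → sumUpTo n f ≡ sumUpTo n g
sumUpTo-cong zero    f≗g = f≗g 0
sumUpTo-cong (suc n) f≗g = cong₂ _+_ (sumUpTo-cong n f≗g) (f≗g (suc n))

sumUpTo-*ˡ : ∀ n c (f : ℕ → ℕ) → sumUpTo n (λ i → c * f i) ≡ c * sumUpTo n f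
sumUpTo-*ˡ zero    c f = refl
sumUpTo-*ˡ (suc n) c f =
  trans (cong (_+ c * f (suc n)) (sumUpTo-*ˡ n c f)) (sym (*-distribˡ-+ c _ _))

sumUpTo-suc : ∀ n (f : ℕ → ℕ) → sumUpTo (suc n) f ≡ f 0 + sumUpTo n (f ∘ suc)
sumUpTo-suc zero    f = refl
sumUpTo-suc (suc n) f = trans (cong (_+ f (suc (suc n))) (sumUpTo-suc n f)) (+-assoc (f 0) _ _)

𝟙 : ∀ {a} {P : Set a} → Dec P → ℕ
𝟙 (yes _) = 1
𝟙 (no _)  = 0

module _ {a b} {P : Set a} {Q : Set b} where

  𝟙-cong : P ⇔ Q → (d : Dec P) (e : Dec Q) → 𝟙 d ≡ 𝟙 e
  𝟙-cong P⇔Q (yes p) (yes q) = refl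
  𝟙-cong P⇔Q (yes p) (no ¬q) = ⊥-elim (¬q (Equivalence.to P⇔Q p))
  𝟙-cong P⇔Q (no ¬p) (yes q) = ⊥-elim (¬p (Equivalence.from P⇔Q q))
  𝟙-cong P⇔Q (no ¬p) (no ¬q) = refl

  𝟙-× : (d : Dec P) (e : Dec Q) → 𝟙 (d ×-dec e) ≡ 𝟙 d * 𝟙 e
  𝟙-× (yes _) (yes _) = refl
  𝟙-× (yes _) (no _)  = refl
  𝟙-× (no _)  _       = refl

module _ {a} {P : Set a} where

  𝟙-yes : P → (d : Dec P) → 𝟙 d ≡ 1
  𝟙-yes p (yes _) = refl
  𝟙-yes p (no ¬p) = ⊥-elim (¬p p)

  𝟙-no : ¬ P → (d : Dec P) → 𝟙 d ≡ 0
  𝟙-no ¬p (yes p) = ⊥-elim (¬p p)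
  𝟙-no ¬p (no _)  = refl

  *-𝟙-split : (d : Dec P) → ∀ x → x ≡ x * 𝟙 d + x * 𝟙 (¬? d)
  *-𝟙-split (yes _) x = sym (trans (cong₂ _+_ (*-identityʳ x) (*-zeroʳ x)) (+-identityʳ x))
  *-𝟙-split (no _)  x = sym (trans (cong (_+ x * 1) (*-zeroʳ x)) (*-identityʳ x))

length-filter : ∀ {A : Set} {P : A → Set} (P? : ∀ x → Dec (P x)) xs →
  length (filter P? xs) ≡ sum (List.map (𝟙 ∘ P?) xs)
length-filter P? List.[] = refl
length-filter P? (x List.∷ xs) with P? x
... | yes _ = cong suc (length-filter P? xs)
... | no  _ = length-filter P? xs

sum-map-concatMap : ∀ {A B : Set} (f : B → ℕ) (g : A → List B) xs →
  sum (List.map f (concatMap g xs)) ≡ sum (List.map (λ x → sum (List.map f (g x))) xs)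
sum-map-concatMap f g List.[] = refl
sum-map-concatMap f g (x List.∷ xs) = begin
  sum (List.map f (g x List.++ concatMap g xs))
    ≡⟨ cong sum (map-++ f (g x) _) ⟩
  sum (List.map f (g x) List.++ List.map f (concatMap g xs))
    ≡⟨ sum-++ (List.map f (g x)) _ ⟩
  sum (List.map f (g x)) + sum (List.map f (concatMap g xs))
    ≡⟨ cong (_+_ (sum (List.map f (g x)))) (sum-map-concatMap f g xs) ⟩
  sum (List.map f (g x)) + sum (List.map (λ x → sum (List.map f (g x))) xs) ∎
  where open ≡-Reasoning

sum-tabulate : ∀ n (g : Fin n → ℕ) (h : ℕ → ℕ) → (∀ i → g i ≡ h (toℕ i)) →
  sum (tabulate g) ≡ sumBelow n h
sum-tabulate zero    g h g≗h = refl
sum-tabulate (suc n) g h g≗h =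
  cong₂ _+_ (g≗h Fin.zero) (sum-tabulate n (g ∘ Fin.suc) (h ∘ suc) (g≗h ∘ Fin.suc))
  where import Data.Fin as Fin

sum-allTuples : ∀ k n (g : Vec (Fin n) k → ℕ) (h : Vec ℕ k → ℕ) → (∀ v → g v ≡ h (Vec.map toℕ v)) →
  sum (List.map g (allTuples k n)) ≡ sumTuples k n h
sum-allTuples zero    n g h g≗h = trans (+-identityʳ _) (g≗h [])
sum-allTuples (suc k) n g h g≗h = begin
  sum (List.map g (concatMap (λ x → List.map (x ∷_) (allTuples k n)) (allFin n)))
    ≡⟨ sum-map-concatMap g _ (allFin n) ⟩
  sum (List.map (λ x → sum (List.map g (List.map (x ∷_) (allTuples k n)))) (allFin n))
    ≡⟨ cong sum (map-tabulate {n = n} (λ x → x) _) ⟩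
  sum (tabulate (λ x → sum (List.map g (List.map (x ∷_) (allTuples k n)))))
    ≡⟨ sum-tabulate n _ _ (λ x → trans (cong sum (sym (map-∘ (allTuples k n))))
         (sum-allTuples k n (g ∘ (x ∷_)) (h ∘ (toℕ x ∷_)) (g≗h ∘ (x ∷_)))) ⟩
  sumBelow n (λ x → sumTuples k n (h ∘ (x ∷_))) ∎
  where open ≡-Reasoning

m∣n<m⇒n≡0 : ∀ {m n} → m ∣ n → n < m → n ≡ 0
m∣n<m⇒n≡0 {n = zero}  _   _   = refl
m∣n<m⇒n≡0 {n = suc n} m∣n n<m = contradiction m∣n (>⇒∤ n<m)

module _ {n : ℕ} (a b : ℤ) where

  ≡[mod]⇒∣ : a ≡ b [mod n ] → + n Signed.∣ a ℤ.- b
  ≡[mod]⇒∣ = Signed.∣ᵤ⇒∣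

  ∣⇒≡[mod] : + n Signed.∣ a ℤ.- b → a ≡ b [mod n ]
  ∣⇒≡[mod] = Signed.∣⇒∣ᵤ

≡[mod]-cong : ∀ {n n′} a b a′ b′ → n ≡ n′ → a ℤ.- b ≡ a′ ℤ.- b′ →
  a ≡ b [mod n ] ⇔ a′ ≡ b′ [mod n′ ]
≡[mod]-cong _ _ _ _ refl eq = mk⇔ (subst (λ z → _ ∣ ℤ.∣ z ∣) eq) (subst (λ z → _ ∣ ℤ.∣ z ∣) (sym eq))

∣-resp-≡[mod] : ∀ {n x y} → (+ x) ≡ (+ y) [mod n ] → n ∣ x → n ∣ y
∣-resp-≡[mod] {n} {x} {y} x≡y n∣x = Signed.∣⇒∣ᵤ (subst (+ n Signed.∣_) (cancel (+ x) (+ y))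
  (Signed.∣m∣n⇒∣m-n (Signed.∣ᵤ⇒∣ {+ n} {+ x} n∣x) (≡[mod]⇒∣ (+ x) (+ y) x≡y)))
  where
  cancel : ∀ x y → x ℤ.- (x ℤ.- y) ≡ y
  cancel = ℤ-Solver.solve-∀

≡[mod]-+-multiple : ∀ {n} a d c → n ∣ d → (+ (a + d)) ≡ c [mod n ] ⇔ (+ a) ≡ c [mod n ]
≡[mod]-+-multiple {n} a d c n∣d = mk⇔
  (λ h → ∣⇒≡[mod] (+ a) c
    (Signed.∣m+n∣n⇒∣m (subst (+ n Signed.∣_) diff (≡[mod]⇒∣ (+ (a + d)) c h)) n∣+d))
  (λ h → ∣⇒≡[mod] (+ (a + d)) c
    (subst (+ n Signed.∣_) (sym diff) (Signed.∣m∣n⇒∣m+n (≡[mod]⇒∣ (+ a) c h) n∣+d)))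
  where
  n∣+d : + n Signed.∣ + d
  n∣+d = Signed.∣ᵤ⇒∣ n∣d
  regroup : ∀ a d c → (a ℤ.+ d) ℤ.- c ≡ (a ℤ.- c) ℤ.+ d
  regroup = ℤ-Solver.solve-∀
  diff : + (a + d) ℤ.- c ≡ (+ a ℤ.- c) ℤ.+ + d
  diff = trans (cong (ℤ._- c) (ℤ.pos-+ a d)) (regroup (+ a) (+ d) c)

≡[mod]-*-cancel : ∀ q {n} a b .{{_ : ℕ.NonZero q}} →
  (a ℤ.* + q) ≡ (b ℤ.* + q) [mod n * q ] ⇔ a ≡ b [mod n ]
≡[mod]-*-cancel q {n} a b = mk⇔
  (λ h → ℕ∣.*-cancelʳ-∣ q (subst (n * q ∣_) abs-diff h))
  (λ h → subst (n * q ∣_) (sym abs-diff) (ℕ∣.*-monoˡ-∣ q h))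
  where
  factor : ∀ a b q → a ℤ.* q ℤ.- b ℤ.* q ≡ (a ℤ.- b) ℤ.* q
  factor = ℤ-Solver.solve-∀
  abs-diff : ℤ.∣ a ℤ.* + q ℤ.- b ℤ.* + q ∣ ≡ ℤ.∣ a ℤ.- b ∣ * q
  abs-diff = trans (cong ℤ.∣_∣ (factor a b (+ q))) (ℤ.abs-* (a ℤ.- b) (+ q))

sqNorm : ∀ {k} → Vec ℕ k → ℕ
sqNorm []       = 0
sqNorm (x ∷ xs) = x * x + sqNorm xs

dot : ∀ {k} → Vec ℕ k → Vec ℕ k → ℕ
dot []       []       = 0
dot (e ∷ es) (b ∷ bs) = e * b + dot es bs

Primitive : ℕ → ∀ {k} → Vec ℕ k → Set
Primitive p = Any (λ x → ¬ p ∣ x)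

primitive? : ∀ p {k} (xs : Vec ℕ k) → Dec (Primitive p xs)
primitive? p = any? (λ x → ¬? (p ∣? x))

imprimitive? : ∀ p {k} (xs : Vec ℕ k) → Dec (¬ Primitive p xs)
imprimitive? p xs = ¬? (primitive? p xs)

dot-divisible : ∀ {p k} (e : Vec ℕ k) → ¬ Primitive p e → ∀ bs → p ∣ dot e bs
dot-divisible {p} []       _     []       = p ℕ∣.∣0
dot-divisible {p} (e₀ ∷ e) ¬prim (b ∷ bs) = ℕ∣.∣m∣n⇒∣m+n
  (ℕ∣.∣m⇒∣m*n b (decidable-stable (p ∣? e₀) (¬prim ∘ here))) (dot-divisible e (¬prim ∘ there) bs)

sqNorm-liftBy : ∀ {k} q (a b : Vec ℕ k) →
  sqNorm (liftBy q a b) ≡ sqNorm a + q * (dot (Vec.map (2 *_) a) b + q * sqNorm b)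
sqNorm-liftBy q []       []       = sym (trans (cong (q *_) (*-zeroʳ q)) (*-zeroʳ q))
sqNorm-liftBy q (a ∷ as) (b ∷ bs) = trans
  (cong (λ t → (a + b * q) * (a + b * q) + t) (sqNorm-liftBy q as bs))
  (expand a b q (sqNorm as) (dot (Vec.map (2 *_) as) bs) (sqNorm bs))
  where
  expand : ∀ a b q A D S → (a + b * q) * (a + b * q) + (A + q * (D + q * S))
                          ≡ a * a + A + q * (2 * a * b + D + q * (b * b + S))
  expand = solve-∀

sqNorm-liftBy-zero : ∀ {k} q (b : Vec ℕ k) → sqNorm (liftBy q (Vec.replicate k 0) b) ≡ q * q * sqNorm b
sqNorm-liftBy-zero q []       = sym (*-zeroʳ (q * q))
sqNorm-liftBy-zero q (b ∷ bs) =
  trans (cong (λ t → b * q * (b * q) + t) (sqNorm-liftBy-zero q bs)) (expand b q (sqNorm bs))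
  where
  expand : ∀ b q S → b * q * (b * q) + q * q * S ≡ q * q * (b * b + S)
  expand = solve-∀

module _ {p q : ℕ} (p∣q : p ∣ q) where

  ∣-+-multiple : ∀ a b → p ∣ a + b * q ⇔ p ∣ a
  ∣-+-multiple a b = mk⇔
    (λ p∣a+bq → ℕ∣.∣m+n∣m⇒∣n (subst (p ∣_) (+-comm a (b * q)) p∣a+bq) p∣bq)
    (λ p∣a → ℕ∣.∣m∣n⇒∣m+n p∣a p∣bq)
    where
    p∣bq : p ∣ b * q
    p∣bq = ℕ∣.∣n⇒∣m*n b p∣q

  primitive-liftBy⁻ : ∀ {k} (a b : Vec ℕ k) → Primitive p (liftBy q a b) → Primitive p a
  primitive-liftBy⁻ (a ∷ as) (b ∷ bs) (here p∤a+bq) = here (p∤a+bq ∘ Equivalence.from (∣-+-multiple a b))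
  primitive-liftBy⁻ (a ∷ as) (b ∷ bs) (there prim)  = there (primitive-liftBy⁻ as bs prim)

  primitive-liftBy⁺ : ∀ {k} (a b : Vec ℕ k) → Primitive p a → Primitive p (liftBy q a b)
  primitive-liftBy⁺ (a ∷ as) (b ∷ bs) (here p∤a)   = here (p∤a ∘ Equivalence.to (∣-+-multiple a b))
  primitive-liftBy⁺ (a ∷ as) (b ∷ bs) (there prim) = there (primitive-liftBy⁺ as bs prim)

  primitive-liftBy : ∀ {k} (a b : Vec ℕ k) → Primitive p (liftBy q a b) ⇔ Primitive p a
  primitive-liftBy a b = mk⇔ (primitive-liftBy⁻ a b) (primitive-liftBy⁺ a b)

solution? : ∀ {k} n μ (xs : Vec ℕ k) → Dec ((+ sqNorm xs) ≡ μ [mod n ])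
solution? n μ xs = (+ sqNorm xs) ≡? μ [mod n ]

solutions : (k n : ℕ) → ℤ → ℕ
solutions k n μ = sumTuples k n (𝟙 ∘ solution? n μ)

primitiveSolutions : (k p n : ℕ) → ℤ → ℕ
primitiveSolutions k p n μ = sumTuples k n (λ xs → 𝟙 (solution? n μ xs) * 𝟙 (primitive? p xs))

imprimitiveSolutions : (k p n : ℕ) → ℤ → ℕ
imprimitiveSolutions k p n μ = sumTuples k n (λ xs → 𝟙 (solution? n μ xs) * 𝟙 (imprimitive? p xs))

solutions-split : ∀ k p n μ →
  solutions k n μ ≡ primitiveSolutions k p n μ + imprimitiveSolutions k p n μ
solutions-split k p n μ =
  trans (sumTuples-cong k n (λ xs → *-𝟙-split (primitive? p xs) _)) (sumTuples-distrib k n _ _)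

solutions-periodic : ∀ k n m μ → sumTuples k (n * m) (𝟙 ∘ solution? m μ) ≡ n ^ k * solutions k m μ
solutions-periodic k n m μ = begin
  sumTuples k (n * m) (𝟙 ∘ solution? m μ)
    ≡⟨ sumTuples-digits k n m _ ⟩
  sumTuples k m (λ as → sumTuples k n (λ bs → 𝟙 (solution? m μ (liftBy m as bs))))
    ≡⟨ sumTuples-cong k m (λ as → sumTuples-cong k n (λ bs →
         trans (cong (λ x → 𝟙 ((+ x) ≡? μ [mod m ])) (sqNorm-liftBy m as bs))
               (𝟙-cong (≡[mod]-+-multiple (sqNorm as) (m * carry as bs) μ (ℕ∣.m∣m*n (carry as bs)))
                       _ (solution? m μ as)))) ⟩
  sumTuples k m (λ as → sumTuples k n (λ _ → 𝟙 (solution? m μ as)))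
    ≡⟨ sumTuples-cong k m (λ as → sumTuples-const k n _) ⟩
  sumTuples k m (λ as → n ^ k * 𝟙 (solution? m μ as))
    ≡⟨ sumTuples-*ˡ k m (n ^ k) _ ⟩
  n ^ k * solutions k m μ ∎
  where
  open ≡-Reasoning
  carry : Vec ℕ k → Vec ℕ k → ℕ
  carry as bs = dot (Vec.map (2 *_) as) bs + m * sqNorm bs

sumSq≡sqNorm : ∀ {n k} (v : Vec (Fin n) k) → sumSq v ≡ + sqNorm (Vec.map toℕ v)
sumSq≡sqNorm []      = refl
sumSq≡sqNorm (x ∷ v) = begin
  + toℕ x ℤ.* + toℕ x ℤ.+ sumSq v
    ≡⟨ cong₂ ℤ._+_ (sym (ℤ.pos-* (toℕ x) (toℕ x))) (sumSq≡sqNorm v) ⟩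
  + (toℕ x * toℕ x) ℤ.+ + sqNorm (Vec.map toℕ v)
    ≡⟨ sym (ℤ.pos-+ (toℕ x * toℕ x) _) ⟩
  + sqNorm (Vec.map toℕ (x ∷ v)) ∎
  where open ≡-Reasoning

ρ≡solutions : ∀ k μ n → ρ k μ n ≡ solutions k n μ
ρ≡solutions k μ n = trans (length-filter _ (allTuples k n))
  (sum-allTuples k n _ _ (λ v → cong (λ z → 𝟙 (z ≡? μ [mod n ])) (sumSq≡sqNorm v)))

ρ⁽¹⁾≡primitiveSolutions : ∀ k μ p t → ρ⁽¹⁾ k μ p t ≡ primitiveSolutions k p (p ^ t) μ
ρ⁽¹⁾≡primitiveSolutions k μ p t = trans (length-filter _ (allTuples k (p ^ t)))
  (sum-allTuples k (p ^ t) _ _ (λ v →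
    trans (𝟙-× (sumSq v ≡? μ [mod p ^ t ]) (any? (λ x → ¬? (p ∣? toℕ x)) v))
          (cong₂ _*_ (cong (λ z → 𝟙 (z ≡? μ [mod p ^ t ])) (sumSq≡sqNorm v))
                     (𝟙-cong (mk⇔ Anyₚ.map⁺ Anyₚ.map⁻) _ _))))

-- Linear congruences and imprimitive solutions modulo a prime

module _ {p : ℕ} (p-prime : Prime p) where

  private instance
    p-nonZero : ℕ.NonZero p
    p-nonZero = prime⇒nonZero p-prime

  ∤⇒coprime : ∀ {e} → ¬ p ∣ e → Coprime e p
  ∤⇒coprime p∤e (d∣e , d∣p) with prime⇒irreducible p-prime d∣p
  ... | inj₁ d≡1 = d≡1
  ... | inj₂ refl = contradiction d∣e p∤e

  inverse-mod : ∀ {e} → ¬ p ∣ e → Σ ℤ λ u → (+ e ℤ.* u) ≡ 1ℤ [mod p ]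
  inverse-mod {e} p∤e with coprime-Bézout (∤⇒coprime p∤e)
  ... | Bézout.+- x y 1+yp≡xe = + x , ∣⇒≡[mod] (+ e ℤ.* + x) 1ℤ (divides (+ y) (begin
    + e ℤ.* + x ℤ.- 1ℤ
      ≡⟨ cong (ℤ._- 1ℤ) (trans (sym (ℤ.pos-* e x)) (cong +_ (trans (*-comm e x) (sym 1+yp≡xe)))) ⟩
    + (1 + y * p) ℤ.- 1ℤ
      ≡⟨ cong (ℤ._- 1ℤ) (trans (ℤ.pos-+ 1 (y * p)) (cong (ℤ._+_ 1ℤ) (ℤ.pos-* y p))) ⟩
    1ℤ ℤ.+ + y ℤ.* + p ℤ.- 1ℤ
      ≡⟨ +-cancel (+ y ℤ.* + p) ⟩
    + y ℤ.* + p ∎))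
    where
    open ≡-Reasoning
    +-cancel : ∀ z → 1ℤ ℤ.+ z ℤ.- 1ℤ ≡ z
    +-cancel = ℤ-Solver.solve-∀
  ... | Bézout.-+ x y 1+xe≡yp = ℤ.- + x , ∣⇒≡[mod] (+ e ℤ.* ℤ.- + x) 1ℤ (divides (ℤ.- + y) (begin
    + e ℤ.* ℤ.- + x ℤ.- 1ℤ
      ≡⟨ negate (+ e) (+ x) ⟩
    ℤ.- (1ℤ ℤ.+ + x ℤ.* + e)
      ≡⟨ cong ℤ.-_ (trans (cong (ℤ._+_ 1ℤ) (sym (ℤ.pos-* x e))) (sym (ℤ.pos-+ 1 (x * e)))) ⟩
    ℤ.- + (1 + x * e)
      ≡⟨ cong (ℤ.-_ ∘ +_) 1+xe≡yp ⟩
    ℤ.- + (y * p)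
      ≡⟨ cong ℤ.-_ (ℤ.pos-* y p) ⟩
    ℤ.- (+ y ℤ.* + p)
      ≡⟨ ℤ.neg-distribˡ-* (+ y) (+ p) ⟩
    ℤ.- + y ℤ.* + p ∎))
    where
    open ≡-Reasoning
    negate : ∀ e x → e ℤ.* ℤ.- x ℤ.- 1ℤ ≡ ℤ.- (1ℤ ℤ.+ x ℤ.* e)
    negate = ℤ-Solver.solve-∀

  linear-solvable : ∀ {e} → ¬ p ∣ e → ∀ c → Σ ℕ λ b → b < p × (+ (e * b)) ≡ c [mod p ]
  linear-solvable {e} p∤e c with inverse-mod p∤e
  ... | u , eu≡1 = b , n%ℕd<d w p , ∣⇒≡[mod] (+ (e * b)) c (subst (+ p Signed.∣_) (sym split)
        (Signed.∣m∣n⇒∣m+n (Signed.∣n⇒∣m*n (+ e) p∣b-w)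
                          (Signed.∣n⇒∣m*n c (≡[mod]⇒∣ (+ e ℤ.* u) 1ℤ eu≡1))))
    where
    w = c ℤ.* u
    b = w %ℕ p
    regroup : ∀ e b c u → e ℤ.* b ℤ.- c ≡ e ℤ.* (b ℤ.- c ℤ.* u) ℤ.+ c ℤ.* (e ℤ.* u ℤ.- 1ℤ)
    regroup = ℤ-Solver.solve-∀
    split : + (e * b) ℤ.- c ≡ + e ℤ.* (+ b ℤ.- w) ℤ.+ c ℤ.* (+ e ℤ.* u ℤ.- 1ℤ)
    split = trans (cong (ℤ._- c) (ℤ.pos-* e b)) (regroup (+ e) (+ b) c u)
    remainder : ∀ b q p → b ℤ.- (b ℤ.+ q ℤ.* p) ≡ ℤ.- q ℤ.* p
    remainder = ℤ-Solver.solve-∀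
    p∣b-w : + p Signed.∣ + b ℤ.- w
    p∣b-w = divides (ℤ.- (w /ℕ p))
      (trans (cong (ℤ._-_ (+ b)) (a≡a%ℕn+[a/ℕn]*n w p)) (remainder (+ b) (w /ℕ p) (+ p)))

  linear-unique : ∀ {e c b b′} → ¬ p ∣ e → b < p → b′ < p →
    (+ (e * b)) ≡ c [mod p ] → (+ (e * b′)) ≡ c [mod p ] → b ≡ b′
  linear-unique {e} {c} {b} {b′} p∤e b<p b′<p eb≡c eb′≡c =
    ℤ.+-injective (i-j≡0⇒i≡j (+ b) (+ b′) (∣i∣≡0⇒i≡0 (m∣n<m⇒n≡0 p∣∣b-b′∣ ∣b-b′∣<p)))
    where
    difference : ∀ e b b′ c → e ℤ.* (b ℤ.- b′) ≡ (e ℤ.* b ℤ.- c) ℤ.- (e ℤ.* b′ ℤ.- c)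
    difference = ℤ-Solver.solve-∀
    p∣e[b-b′] : + p Signed.∣ + e ℤ.* (+ b ℤ.- + b′)
    p∣e[b-b′] = subst (+ p Signed.∣_)
      (sym (trans (difference (+ e) (+ b) (+ b′) c)
                  (cong₂ (λ x y → (x ℤ.- c) ℤ.- (y ℤ.- c)) (sym (ℤ.pos-* e b)) (sym (ℤ.pos-* e b′)))))
      (Signed.∣m∣n⇒∣m-n (≡[mod]⇒∣ (+ (e * b)) c eb≡c) (≡[mod]⇒∣ (+ (e * b′)) c eb′≡c))
    p∣e*∣b-b′∣ : p ∣ e * ℤ.∣ + b ℤ.- + b′ ∣
    p∣e*∣b-b′∣ = subst (p ∣_) (ℤ.abs-* (+ e) _) (Signed.∣⇒∣ᵤ p∣e[b-b′])
    p∣∣b-b′∣ : p ∣ ℤ.∣ + b ℤ.- + b′ ∣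
    p∣∣b-b′∣ = fromInj₂ (λ p∣e → contradiction p∣e p∤e) (euclidsLemma e _ p-prime p∣e*∣b-b′∣)
    ∣b-b′∣<p : ℤ.∣ + b ℤ.- + b′ ∣ < p
    ∣b-b′∣<p = ≤-<-trans
      (subst (_≤ b ℕ.⊔ b′) (cong ℤ.∣_∣ (sym ([+m]-[+n]≡m⊖n b b′))) (∣m⊝n∣≤m⊔n b b′))
      (⊔-lub b<p b′<p)

  count-linear₁ : ∀ {e} → ¬ p ∣ e → ∀ c → sumBelow p (λ b → 𝟙 ((+ (e * b)) ≡? c [mod p ])) ≡ 1
  count-linear₁ {e} p∤e c = unique-solution (linear-solvable p∤e c)
    where
    solves : ℕ → ℕ
    solves b = 𝟙 ((+ (e * b)) ≡? c [mod p ])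
    unique-solution : (Σ ℕ λ b → b < p × (+ (e * b)) ≡ c [mod p ]) → sumBelow p solves ≡ 1
    unique-solution (b₀ , b₀<p , eb₀≡c) = trans
      (sumBelow-single p b₀ solves b₀<p (λ b b<p b≢b₀ →
        𝟙-no (λ eb≡c → b≢b₀ (linear-unique {e} {c} p∤e b<p b₀<p eb≡c eb₀≡c))
             ((+ (e * b)) ≡? c [mod p ])))
      (𝟙-yes eb₀≡c ((+ (e * b₀)) ≡? c [mod p ]))

  count-linear : ∀ {k} (e : Vec ℕ (suc k)) → Primitive p e → ∀ c →
    sumTuples (suc k) p (λ bs → 𝟙 ((+ dot e bs) ≡? c [mod p ])) ≡ p ^ k
  count-linear {k} (e₀ ∷ e) prim c with primitive? p e
  ... | no ¬prim = begin
    sumBelow p (λ b → sumTuples k p (λ bs → 𝟙 ((+ (e₀ * b + dot e bs)) ≡? c [mod p ])))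
      ≡⟨ sumBelow-cong p (λ b → sumTuples-cong k p (λ bs →
           𝟙-cong (≡[mod]-+-multiple (e₀ * b) (dot e bs) c (dot-divisible e ¬prim bs))
                  ((+ (e₀ * b + dot e bs)) ≡? c [mod p ]) ((+ (e₀ * b)) ≡? c [mod p ]))) ⟩
    sumBelow p (λ b → sumTuples k p (λ _ → 𝟙 ((+ (e₀ * b)) ≡? c [mod p ])))
      ≡⟨ sumBelow-cong p (λ b → sumTuples-const k p _) ⟩
    sumBelow p (λ b → p ^ k * 𝟙 ((+ (e₀ * b)) ≡? c [mod p ]))
      ≡⟨ sumBelow-*ˡ p (p ^ k) _ ⟩
    p ^ k * sumBelow p (λ b → 𝟙 ((+ (e₀ * b)) ≡? c [mod p ]))
      ≡⟨ cong (p ^ k *_) (count-linear₁ (head-unit prim) c) ⟩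
    p ^ k * 1
      ≡⟨ *-identityʳ _ ⟩
    p ^ k ∎
    where
    open ≡-Reasoning
    head-unit : Primitive p (e₀ ∷ e) → ¬ p ∣ e₀
    head-unit (here p∤e₀)   = p∤e₀
    head-unit (there prim′) = contradiction prim′ ¬prim
  count-linear {suc k} (e₀ ∷ e) prim c | yes prim′ = begin
    sumBelow p (λ b → sumTuples (suc k) p (λ bs → 𝟙 ((+ (e₀ * b + dot e bs)) ≡? c [mod p ])))
      ≡⟨ sumBelow-cong p (λ b → sumTuples-cong (suc k) p (λ bs → 𝟙-cong (move (e₀ * b) (dot e bs))
           ((+ (e₀ * b + dot e bs)) ≡? c [mod p ]) ((+ dot e bs) ≡? c ℤ.- + (e₀ * b) [mod p ]))) ⟩
    sumBelow p (λ b → sumTuples (suc k) p (λ bs → 𝟙 ((+ dot e bs) ≡? c ℤ.- + (e₀ * b) [mod p ])))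
      ≡⟨ sumBelow-cong p (λ b → count-linear e prim′ (c ℤ.- + (e₀ * b))) ⟩
    sumBelow p (λ _ → p ^ k)
      ≡⟨ sumBelow-const p _ ⟩
    p ^ suc k ∎
    where
    open ≡-Reasoning
    regroup : ∀ x y c → (x ℤ.+ y) ℤ.- c ≡ y ℤ.- (c ℤ.- x)
    regroup = ℤ-Solver.solve-∀
    move : ∀ x y → (+ (x + y)) ≡ c [mod p ] ⇔ (+ y) ≡ c ℤ.- + x [mod p ]
    move x y = ≡[mod]-cong (+ (x + y)) c (+ y) (c ℤ.- + x) refl
      (trans (cong (ℤ._- c) (ℤ.pos-+ x y)) (regroup (+ x) (+ y) c))

  sumTuples-imprimitive : ∀ k (g : Vec ℕ k → ℕ) →
    sumTuples k p (λ as → 𝟙 (imprimitive? p as) * g as) ≡ g (Vec.replicate k 0)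
  sumTuples-imprimitive zero    g = +-identityʳ (g [])
  sumTuples-imprimitive (suc k) g =
    trans (sumBelow-single p 0 column (>-nonZero⁻¹ p) nonzero-head)
          (trans (sumTuples-cong k p (λ as → cong (_* g (0 ∷ as))
                    (𝟙-cong zero-head (imprimitive? p (0 ∷ as)) (imprimitive? p as))))
                 (sumTuples-imprimitive k (g ∘ (0 ∷_))))
    where
    column : ℕ → ℕ
    column x = sumTuples k p (λ as → 𝟙 (imprimitive? p (x ∷ as)) * g (x ∷ as))
    tail-primitive : ∀ {as} → Primitive p (0 ∷ as) → Primitive p as
    tail-primitive (here p∤0)   = contradiction (p ℕ∣.∣0) p∤0
    tail-primitive (there prim) = prim
    zero-head : ∀ {as} → (¬ Primitive p (0 ∷ as)) ⇔ (¬ Primitive p as)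
    zero-head = mk⇔ (λ ¬prim → ¬prim ∘ there) (λ ¬prim → ¬prim ∘ tail-primitive)
    nonzero-head : ∀ x → x < p → x ≢ 0 → column x ≡ 0
    nonzero-head x x<p x≢0 = sumTuples-zero k p _ (λ as → cong (_* g (x ∷ as))
      (𝟙-no (λ ¬prim → ¬prim (here (x≢0 ∘ λ p∣x → m∣n<m⇒n≡0 p∣x x<p))) (imprimitive? p (x ∷ as))))

  imprimitiveSolutions-p* : ∀ k m μ → imprimitiveSolutions k p (p * m) μ
    ≡ sumTuples k m (λ bs → 𝟙 ((+ (p * p * sqNorm bs)) ≡? μ [mod p * m ]))
  imprimitiveSolutions-p* k m μ = begin
    sumTuples k (p * m) h
      ≡⟨ cong (λ n → sumTuples k n h) (*-comm p m) ⟩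
    sumTuples k (m * p) h
      ≡⟨ sumTuples-digits k m p h ⟩
    sumTuples k p (λ as → sumTuples k m (λ bs → h (liftBy p as bs)))
      ≡⟨ sumTuples-cong k p (λ as → trans (sumTuples-cong k m (λ bs → trans
           (cong (C (liftBy p as bs) *_) (𝟙-cong (¬-⇔ (primitive-liftBy ℕ∣.∣-refl as bs))
                                           (imprimitive? p (liftBy p as bs)) (imprimitive? p as)))
           (*-comm (C (liftBy p as bs)) (𝟙 (imprimitive? p as)))))
           (sumTuples-*ˡ k m (𝟙 (imprimitive? p as)) (C ∘ liftBy p as))) ⟩
    sumTuples k p (λ as → 𝟙 (imprimitive? p as) * sumTuples k m (λ bs → C (liftBy p as bs)))
      ≡⟨ sumTuples-imprimitive k _ ⟩
    sumTuples k m (λ bs → C (liftBy p (Vec.replicate k 0) bs))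
      ≡⟨ sumTuples-cong k m (λ bs → cong (λ x → 𝟙 ((+ x) ≡? μ [mod p * m ])) (sqNorm-liftBy-zero p bs)) ⟩
    sumTuples k m (λ bs → 𝟙 ((+ (p * p * sqNorm bs)) ≡? μ [mod p * m ])) ∎
    where
    open ≡-Reasoning
    C : Vec ℕ k → ℕ
    C = 𝟙 ∘ solution? (p * m) μ
    h : Vec ℕ k → ℕ
    h xs = C xs * 𝟙 (imprimitive? p xs)
    ¬-⇔ : ∀ {A B : Set} → A ⇔ B → (¬ A) ⇔ (¬ B)
    ¬-⇔ A⇔B = mk⇔ (λ ¬a → ¬a ∘ Equivalence.from A⇔B) (λ ¬b → ¬b ∘ Equivalence.to A⇔B)

  imprimitiveSolutions-vanish : ∀ {k m d l} → d ∣ p * m → d ∣ p * p → ¬ d ∣ l →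
    imprimitiveSolutions k p (p * m) (+ l) ≡ 0
  imprimitiveSolutions-vanish {k} {m} {d} {l} d∣pm d∣pp d∤l =
    trans (imprimitiveSolutions-p* k m (+ l)) (sumTuples-zero k m _ (λ bs → 𝟙-no
      (λ p²X≡l → d∤l (∣-resp-≡[mod] (ℕ∣.∣-trans d∣pm p²X≡l) (ℕ∣.∣m⇒∣m*n (sqNorm bs) d∣pp)))
      ((+ (p * p * sqNorm bs)) ≡? + l [mod p * m ])))

  imprimitiveSolutions-descend : ∀ k m l →
    imprimitiveSolutions k p (p * (p * m)) (+ (p * p * l)) ≡ p ^ k * solutions k m (+ l)
  imprimitiveSolutions-descend k m l = begin
    imprimitiveSolutions k p (p * (p * m)) (+ (p * p * l))
      ≡⟨ imprimitiveSolutions-p* k (p * m) (+ (p * p * l)) ⟩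
    sumTuples k (p * m) (λ bs → 𝟙 ((+ (p * p * sqNorm bs)) ≡? + (p * p * l) [mod p * (p * m) ]))
      ≡⟨ sumTuples-cong k (p * m) (λ bs → 𝟙-cong (cancel-p² (sqNorm bs))
           ((+ (p * p * sqNorm bs)) ≡? + (p * p * l) [mod p * (p * m) ]) (solution? m (+ l) bs)) ⟩
    sumTuples k (p * m) (𝟙 ∘ solution? m (+ l))
      ≡⟨ solutions-periodic k p m (+ l) ⟩
    p ^ k * solutions k m (+ l) ∎
    where
    open ≡-Reasoning
    scale : ∀ x → + (p * p * x) ≡ + x ℤ.* + (p * p)
    scale x = trans (cong +_ (*-comm (p * p) x)) (ℤ.pos-* x (p * p))
    cancel-p² : ∀ x → (+ (p * p * x)) ≡ (+ (p * p * l)) [mod p * (p * m) ] ⇔ (+ x) ≡ (+ l) [mod m ]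
    cancel-p² x = ⇔-trans
      (≡[mod]-cong (+ (p * p * x)) (+ (p * p * l)) (+ x ℤ.* + (p * p)) (+ l ℤ.* + (p * p))
                   (trans (sym (*-assoc p p m)) (*-comm (p * p) m)) (cong₂ ℤ._-_ (scale x) (scale l)))
      (≡[mod]-*-cancel (p * p) (+ x) (+ l) {{m*n≢0 p p}})

-- Lifting primitive solutions modulo an odd prime

module _ {p : ℕ} (p-prime : Prime p) (p≢2 : p ≢ 2) where

  private instance
    p-nonZero : ℕ.NonZero p
    p-nonZero = prime⇒nonZero p-prime

  ∤2 : ¬ p ∣ 2
  ∤2 p∣2 with prime⇒irreducible prime[2] p∣2
  ... | inj₁ refl = ¬prime[1] p-prime
  ... | inj₂ p≡2  = p≢2 p≡2

  primitive-double : ∀ {k} {a : Vec ℕ k} → Primitive p a → Primitive p (Vec.map (2 *_) a)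
  primitive-double = Anyₚ.map⁺ ∘ Any.map (λ p∤x p∣2x →
    p∤x (fromInj₂ (λ p∣2 → contradiction p∣2 ∤2) (euclidsLemma 2 _ p-prime p∣2x)))

  fiber-count : ∀ {k q} .{{_ : ℕ.NonZero q}} → p ∣ q → (a : Vec ℕ (suc k)) → Primitive p a → ∀ μ →
    sumTuples (suc k) p (λ bs → 𝟙 (solution? (p * q) μ (liftBy q a bs))) ≡ p ^ k * 𝟙 (solution? q μ a)
  fiber-count {k} {q} p∣q a prim μ with solution? q μ a
  ... | no a≢μ = trans
    (sumTuples-zero (suc k) p _ (λ bs → 𝟙-no (a≢μ ∘ descend bs) (solution? (p * q) μ (liftBy q a bs))))
    (sym (*-zeroʳ (p ^ k)))
    where
    descend : ∀ bs → (+ sqNorm (liftBy q a bs)) ≡ μ [mod p * q ] → (+ sqNorm a) ≡ μ [mod q ]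
    descend bs = Equivalence.to (≡[mod]-+-multiple (sqNorm a) _ μ (ℕ∣.m∣m*n _))
               ∘ subst (λ x → (+ x) ≡ μ [mod q ]) (sqNorm-liftBy q a bs)
               ∘ ℕ∣.∣-trans (ℕ∣.n∣m*n p)
  ... | yes a≡μ with ≡[mod]⇒∣ (+ sqNorm a) μ a≡μ
  ...   | divides c a-μ≡cq = begin
    sumTuples (suc k) p (λ bs → 𝟙 (solution? (p * q) μ (liftBy q a bs)))
      ≡⟨ sumTuples-cong (suc k) p (λ bs → 𝟙-cong (lifted⇔linear bs)
           (solution? (p * q) μ (liftBy q a bs)) ((+ dot a₂ bs) ≡? ℤ.- c [mod p ])) ⟩
    sumTuples (suc k) p (λ bs → 𝟙 ((+ dot a₂ bs) ≡? ℤ.- c [mod p ]))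
      ≡⟨ count-linear p-prime a₂ (primitive-double prim) (ℤ.- c) ⟩
    p ^ k
      ≡⟨ sym (*-identityʳ _) ⟩
    p ^ k * 1 ∎
    where
    open ≡-Reasoning
    a₂ = Vec.map (2 *_) a
    carry : Vec ℕ (suc k) → ℕ
    carry bs = dot a₂ bs + q * sqNorm bs
    regroup : ∀ A X μ c q → A ℤ.- μ ≡ c ℤ.* q → (A ℤ.+ q ℤ.* X) ℤ.- μ ≡ X ℤ.* q ℤ.- ℤ.- c ℤ.* q
    regroup A X μ c q hyp = trans (shuffle A X μ q) (trans (cong (ℤ._+ q ℤ.* X) hyp) (finish X c q))
      where
      shuffle : ∀ A X μ q → (A ℤ.+ q ℤ.* X) ℤ.- μ ≡ (A ℤ.- μ) ℤ.+ q ℤ.* X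
      shuffle = ℤ-Solver.solve-∀
      finish : ∀ X c q → c ℤ.* q ℤ.+ q ℤ.* X ≡ X ℤ.* q ℤ.- ℤ.- c ℤ.* q
      finish = ℤ-Solver.solve-∀
    difference : ∀ bs → (+ sqNorm (liftBy q a bs)) ℤ.- μ ≡ (+ carry bs) ℤ.* + q ℤ.- ℤ.- c ℤ.* + q
    difference bs = begin
      (+ sqNorm (liftBy q a bs)) ℤ.- μ
        ≡⟨ cong (λ x → + x ℤ.- μ) (sqNorm-liftBy q a bs) ⟩
      (+ (sqNorm a + q * carry bs)) ℤ.- μ
        ≡⟨ cong (ℤ._- μ) (trans (ℤ.pos-+ (sqNorm a) _) (cong (ℤ._+_ (+ sqNorm a)) (ℤ.pos-* q _))) ⟩
      (+ sqNorm a ℤ.+ + q ℤ.* + carry bs) ℤ.- μ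
        ≡⟨ regroup (+ sqNorm a) _ μ c (+ q) a-μ≡cq ⟩
      (+ carry bs) ℤ.* + q ℤ.- ℤ.- c ℤ.* + q ∎
    lifted⇔linear : ∀ bs → (+ sqNorm (liftBy q a bs)) ≡ μ [mod p * q ] ⇔ (+ dot a₂ bs) ≡ ℤ.- c [mod p ]
    lifted⇔linear bs = ⇔-trans
      (≡[mod]-cong (+ sqNorm (liftBy q a bs)) μ (+ carry bs ℤ.* + q) (ℤ.- c ℤ.* + q) refl (difference bs))
      (⇔-trans (≡[mod]-*-cancel q (+ carry bs) (ℤ.- c))
               (≡[mod]-+-multiple (dot a₂ bs) (q * sqNorm bs) (ℤ.- c) (ℕ∣.∣m⇒∣m*n (sqNorm bs) p∣q)))

  primitiveSolutions-p* : ∀ {k q} .{{_ : ℕ.NonZero q}} → p ∣ q → ∀ μ →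
    primitiveSolutions (suc k) p (p * q) μ ≡ p ^ k * primitiveSolutions (suc k) p q μ
  primitiveSolutions-p* {k} {q} p∣q μ = begin
    primitiveSolutions (suc k) p (p * q) μ
      ≡⟨ sumTuples-digits (suc k) p q (λ xs → 𝟙 (solution? (p * q) μ xs) * 𝟙 (primitive? p xs)) ⟩
    sumTuples (suc k) q (λ a → sumTuples (suc k) p (λ bs → C a bs * 𝟙 (primitive? p (liftBy q a bs))))
      ≡⟨ sumTuples-cong (suc k) q (λ a → trans
           (sumTuples-cong (suc k) p (λ bs → cong (C a bs *_)
             (𝟙-cong (primitive-liftBy p∣q a bs) (primitive? p (liftBy q a bs)) (primitive? p a))))
           (fiber a (primitive? p a))) ⟩
    sumTuples (suc k) q (λ a → p ^ k * (𝟙 (solution? q μ a) * 𝟙 (primitive? p a)))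
      ≡⟨ sumTuples-*ˡ (suc k) q (p ^ k) (λ a → 𝟙 (solution? q μ a) * 𝟙 (primitive? p a)) ⟩
    p ^ k * primitiveSolutions (suc k) p q μ ∎
    where
    open ≡-Reasoning
    C : Vec ℕ (suc k) → Vec ℕ (suc k) → ℕ
    C a bs = 𝟙 (solution? (p * q) μ (liftBy q a bs))
    fiber : ∀ a (d : Dec (Primitive p a)) →
      sumTuples (suc k) p (λ bs → C a bs * 𝟙 d) ≡ p ^ k * (𝟙 (solution? q μ a) * 𝟙 d)
    fiber a (yes prim) = trans (sumTuples-cong (suc k) p (λ bs → *-identityʳ (C a bs)))
      (trans (fiber-count p∣q a prim μ) (cong (p ^ k *_) (sym (*-identityʳ _))))
    fiber a (no _) = trans (sumTuples-zero (suc k) p _ (λ bs → *-zeroʳ (C a bs)))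
      (sym (trans (cong (p ^ k *_) (*-zeroʳ (𝟙 (solution? q μ a)))) (*-zeroʳ (p ^ k))))

  primitiveSolutions-p^ : ∀ {k} t μ →
    primitiveSolutions (suc k) p (p ^ suc t) μ ≡ p ^ (t * k) * primitiveSolutions (suc k) p (p ^ 1) μ
  primitiveSolutions-p^ zero    μ = sym (*-identityˡ _)
  primitiveSolutions-p^ {k} (suc t) μ = begin
    primitiveSolutions (suc k) p (p * p ^ suc t) μ
      ≡⟨ primitiveSolutions-p* {k} {p ^ suc t} {{m^n≢0 p (suc t)}} (ℕ∣.m∣m*n (p ^ t)) μ ⟩
    p ^ k * primitiveSolutions (suc k) p (p ^ suc t) μ
      ≡⟨ cong (p ^ k *_) (primitiveSolutions-p^ t μ) ⟩
    p ^ k * (p ^ (t * k) * P)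
      ≡⟨ sym (*-assoc (p ^ k) _ _) ⟩
    p ^ k * p ^ (t * k) * P
      ≡⟨ cong (_* P) (sym (^-distribˡ-+-* p k (t * k))) ⟩
    p ^ (k + t * k) * P ∎
    where
    open ≡-Reasoning
    P = primitiveSolutions (suc k) p (p ^ 1) μ

  -- The recursion on the exponent of p in λ

  module _ (k : ℕ) where

    summand : ℕ → ℕ → ℕ → ℕ
    summand s l i = p ^ (suc k * i + (s ∸ 2 * i ∸ 1) * k)
      * primitiveSolutions (suc k) p (p ^ 1) (+ ((l / p ^ (2 * i)) {{m^n≢0 p (2 * i)}}))

    summand-zero : ∀ s l → p ^ (s * k) * primitiveSolutions (suc k) p (p ^ 1) (+ l) ≡ summand (suc s) l 0
    summand-zero s l = cong₂ (λ e x → p ^ e * primitiveSolutions (suc k) p (p ^ 1) (+ x))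
      (cong (_+ s * k) (sym (*-zeroʳ (suc k)))) (sym (n/1≡n l))

    summand-suc : ∀ s l i → summand (3 + s) (p * p * l) (suc i) ≡ p ^ suc k * summand (suc s) l i
    summand-suc s l i = trans
      (cong₂ _*_ (trans (cong (p ^_) exponent) (^-distribˡ-+-* p (suc k) _))
                 (cong (primitiveSolutions (suc k) p (p ^ 1) ∘ +_) quotient))
      (*-assoc (p ^ suc k) _ _)
      where
      exponent : suc k * suc i + (3 + s ∸ 2 * suc i ∸ 1) * k ≡ suc k + (suc k * i + (suc s ∸ 2 * i ∸ 1) * k)
      exponent = trans (cong₂ _+_ (*-suc (suc k) i) (cong (λ e → (3 + s ∸ e ∸ 1) * k) (*-suc 2 i)))
                       (+-assoc (suc k) (suc k * i) _)
      instance
        p^2i-nonZero : ℕ.NonZero (p ^ (2 * i))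
        p^2i-nonZero = m^n≢0 p (2 * i)
        p^2+2i-nonZero : ℕ.NonZero (p ^ (2 * suc i))
        p^2+2i-nonZero = m^n≢0 p (2 * suc i)
        p²p^2i-nonZero : ℕ.NonZero (p * p * p ^ (2 * i))
        p²p^2i-nonZero = m*n≢0 (p * p) (p ^ (2 * i)) {{m*n≢0 p p}}
      quotient : (p * p * l) / p ^ (2 * suc i) ≡ l / p ^ (2 * i)
      quotient = trans (/-congʳ (trans (cong (p ^_) (*-suc 2 i)) (sym (*-assoc p p _))))
                       (m*n/m*o≡n/o (p * p) l (p ^ (2 * i)))

    solutions-p^ : ∀ s l → solutions (suc k) (p ^ suc s) (+ l)
      ≡ summand (suc s) l 0 + imprimitiveSolutions (suc k) p (p ^ suc s) (+ l)
    solutions-p^ s l = trans (solutions-split (suc k) p (p ^ suc s) (+ l))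
      (cong (_+ imprimitiveSolutions (suc k) p (p ^ suc s) (+ l))
            (trans (primitiveSolutions-p^ s (+ l)) (summand-zero s l)))

    solutions-formula : ∀ r s l l′ → r < s → l ≡ p ^ r * l′ → ¬ p ∣ l′ →
      solutions (suc k) (p ^ s) (+ l) ≡ sumUpTo (r / 2) (summand s l)
    solutions-formula zero (suc s) l l′ _ l≡l′ p∤l′ =
      trans (solutions-p^ s l) (trans (cong (_+_ (summand (suc s) l 0)) no-imprimitive) (+-identityʳ _))
      where
      no-imprimitive : imprimitiveSolutions (suc k) p (p * p ^ s) (+ l) ≡ 0
      no-imprimitive = imprimitiveSolutions-vanish p-prime {suc k} {p ^ s} {p} {l}
        (ℕ∣.m∣m*n (p ^ s)) (ℕ∣.m∣m*n p) (p∤l′ ∘ subst (p ∣_) (trans l≡l′ (*-identityˡ l′)))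
    solutions-formula 1 (suc (suc s)) l l′ _ l≡pl′ p∤l′ =
      trans (solutions-p^ (suc s) l) (trans (cong (_+_ (summand (2 + s) l 0)) no-imprimitive) (+-identityʳ _))
      where
      no-imprimitive : imprimitiveSolutions (suc k) p (p * (p * p ^ s)) (+ l) ≡ 0
      no-imprimitive = imprimitiveSolutions-vanish p-prime {suc k} {p * p ^ s} {p * p} {l}
        (ℕ∣.*-monoʳ-∣ p (ℕ∣.m∣m*n (p ^ s))) ℕ∣.∣-refl
        (p∤l′ ∘ ℕ∣.*-cancelˡ-∣ p ∘ subst (p * p ∣_) (trans l≡pl′ (cong (_* l′) (*-identityʳ p))))
    solutions-formula 1 (suc zero) l l′ (s≤s ()) l≡pl′ p∤l′
    solutions-formula (suc (suc r)) (suc (suc (suc s))) l l′ (s≤s (s≤s r<s)) l≡p²pʳl′ p∤l′ = begin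
      solutions (suc k) (p ^ s′) (+ l)
        ≡⟨ solutions-p^ (2 + s) l ⟩
      summand s′ l 0 + imprimitiveSolutions (suc k) p (p * (p * p ^ suc s)) (+ l)
        ≡⟨ cong (λ x → summand s′ l 0 + imprimitiveSolutions (suc k) p (p ^ s′) (+ x)) l≡p²l₂ ⟩
      summand s′ l 0 + imprimitiveSolutions (suc k) p (p * (p * p ^ suc s)) (+ (p * p * l₂))
        ≡⟨ cong (_+_ (summand s′ l 0)) (imprimitiveSolutions-descend p-prime (suc k) (p ^ suc s) l₂) ⟩
      summand s′ l 0 + p ^ suc k * solutions (suc k) (p ^ suc s) (+ l₂)
        ≡⟨ cong (λ x → summand s′ l 0 + p ^ suc k * x) (solutions-formula r (suc s) l₂ l′ r<s refl p∤l′) ⟩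
      summand s′ l 0 + p ^ suc k * sumUpTo (r / 2) (summand (suc s) l₂)
        ≡⟨ cong (_+_ (summand s′ l 0)) (sym (sumUpTo-*ˡ (r / 2) (p ^ suc k) _)) ⟩
      summand s′ l 0 + sumUpTo (r / 2) (λ i → p ^ suc k * summand (suc s) l₂ i)
        ≡⟨ cong (_+_ (summand s′ l 0)) (sumUpTo-cong (r / 2) (λ i →
             trans (sym (summand-suc s l₂ i)) (cong (λ x → summand s′ x (suc i)) (sym l≡p²l₂)))) ⟩
      summand s′ l 0 + sumUpTo (r / 2) (summand s′ l ∘ suc)
        ≡⟨ sym (sumUpTo-suc (r / 2) (summand s′ l)) ⟩
      sumUpTo (suc (r / 2)) (summand s′ l)
        ≡⟨ cong (λ n → sumUpTo n (summand s′ l)) (sym (m/n≡1+[m∸n]/n {2 + r} {2} (s≤s (s≤s z≤n)))) ⟩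
      sumUpTo ((2 + r) / 2) (summand s′ l) ∎
      where
      open ≡-Reasoning
      s′ = 3 + s
      l₂ = p ^ r * l′
      l≡p²l₂ : l ≡ p * p * l₂
      l≡p²l₂ = trans l≡p²pʳl′ (trans (*-assoc p (p * p ^ r) l′)
        (trans (cong (p *_) (*-assoc p (p ^ r) l′)) (sym (*-assoc p p l₂))))

theorem1 : (p s k l r l′ : ℕ) → (pp : Prime p) → p ≢ 2 → 1 ≤ s → 1 ≤ k →
  0 < l → l < p ^ s → r < s → l ≡ p ^ r * l′ → ¬ (p ∣ l′) →
  ρ k (+ l) (p ^ s) ≡
    sumUpTo (r / 2) (λ i →
      p ^ (k * i + (s ∸ 2 * i ∸ 1) * (k ∸ 1))
        * ρ⁽¹⁾ k (+ ((l / p ^ (2 * i)) {{m^n≢0 p (2 * i) {{prime⇒nonZero pp}}}})) p 1)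
theorem1 p s zero    l r l′ pp p≢2 _ ()
theorem1 p s (suc k) l r l′ pp p≢2 _ _ _ _ r<s l≡pʳl′ p∤l′ = begin
  ρ (suc k) (+ l) (p ^ s)
    ≡⟨ ρ≡solutions (suc k) (+ l) (p ^ s) ⟩
  solutions (suc k) (p ^ s) (+ l)
    ≡⟨ solutions-formula pp p≢2 k r s l l′ r<s l≡pʳl′ p∤l′ ⟩
  sumUpTo (r / 2) (summand pp p≢2 k s l)
    ≡⟨ sumUpTo-cong (r / 2) (λ i → cong (p ^ (suc k * i + (s ∸ 2 * i ∸ 1) * k) *_)
         (sym (ρ⁽¹⁾≡primitiveSolutions (suc k) (+ l/p²ⁱ i) p 1))) ⟩
  sumUpTo (r / 2) (λ i → p ^ (suc k * i + (s ∸ 2 * i ∸ 1) * k) * ρ⁽¹⁾ (suc k) (+ l/p²ⁱ i) p 1) ∎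
  where
  open ≡-Reasoning
  l/p²ⁱ : ℕ → ℕ
  l/p²ⁱ i = (l / p ^ (2 * i)) {{m^n≢0 p (2 * i) {{prime⇒nonZero pp}}}}
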